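{- Let $k$ be an even positive integer. Every $3 \times k$ matrix $X=[x_{ij}]$ with entries in $\mathbb{Z}_k$ contains a fair $2 \times 2$ submatrix.
   Context: A $2 \times 2$ matrix $[y_{ij}]$ over an additive abelian group is called fair if $y_{11} + y_{22} = y_{12} + y_{21}$. A $2\times 2$ submatrix of a matrix is the matrix formed by the entries lying in a choice of two distinct rows and two distinct columns (kept in their original order). -}

module Defs where

open import Data.Nat using (ℕ; suc; NonZero; _%_; _+_)
open import Data.Nat.Divisibility using (_∣_)
open import Data.Fin using (Fin; toℕ; fromℕ<; _<_)
open import Data.Nat.DivMod using (m%n<n)
open import Data.Product using (Σ; _×_; ∃-syntax)
open import Relation.Binary.PropositionalEquality using (_≡_)

ℤ_ : ℕ → Set
ℤ_ k = Fin k

_+ℤ_ : ∀ {k} .{{_ : NonZero k}} → Fin k → Fin k → Fin k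
_+ℤ_ {k} a b = fromℕ< (m%n<n (toℕ a + toℕ b) k)

Fair : ∀ {k} .{{_ : NonZero k}} → (y11 y12 y21 y22 : Fin k) → Set
Fair y11 y12 y21 y22 = (y11 +ℤ y22) ≡ (y12 +ℤ y21)

Matrix : Set → ℕ → ℕ → Set
Matrix A m n = Fin m → Fin n → A

HasFairSubmatrix : ∀ {m n k} .{{_ : NonZero k}} → Matrix (Fin k) m n → Set
HasFairSubmatrix {m} {n} X =
  ∃[ i1 ] ∃[ i2 ] ∃[ j1 ] ∃[ j2 ]
    (i1 < i2) × (j1 < j2) ×
    Fair (X i1 j1) (X i1 j2) (X i2 j1) (X i2 j2)

-- Subtracting two rows of X column by column gives a map d : ℤ_k → ℤ_k, and two columns
-- i < j with d i = d j span a fair submatrix. If no pair of rows gives a fair submatrix,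
-- the three difference maps are bijections of ℤ_k, so each sums to 0 + 1 + ⋯ + (k - 1),
-- which is k/2 modulo k because k is even. But the difference of rows 1 and 3 is the sum of
-- the other two, so k/2 ≡ k/2 + k/2 ≡ 0 (mod k), which is absurd.
module Submission where

open import Defs
open import Data.Nat using (ℕ; NonZero)
open import Data.Nat.Divisibility using (_∣_)

open import Data.Nat using (zero; suc; _+_; _*_; _∸_; _%_; _≤_; z<s; s<s; ≢-nonZero⁻¹)
open import Data.Nat.Properties
  using (+-0-commutativeMonoid; +-commutativeSemigroup; +-assoc; +-identityʳ; *-comm; +-cancelʳ-≡; *-cancelˡ-≡;
         m+[n∸m]≡n; m∸n+n≡m; <⇒≤; n<1+n; m<m*n)
open import Data.Nat.DivMod
  using (m%n<n; %-distribˡ-+; m%n%n≡m%n; [m+n]%n≡m%n; [m+kn]%n≡m%n; m<n⇒m%n≡m; n%n≡0)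
open import Data.Nat.Divisibility using (divides)
open import Data.Nat.Solver using (module +-*-Solver)
open import Data.Fin as Fin using (Fin; toℕ; fromℕ<; punchOut)
open import Data.Fin.Properties
  using (_≟_; _<?_; any?; <-cmp; toℕ-fromℕ<; fromℕ<-cong; toℕ<n; toℕ-inject₁; toℕ-fromℕ;
         punchOut-injective; <⇒notInjective)
open import Data.Fin.Patterns using (0F; 1F; 2F)
open import Data.Fin.Permutation using (Permutation; permutation)
open import Algebra.Properties.CommutativeMonoid.Sum +-0-commutativeMonoid
  using (sum; sum-cong-≗; sum-init-last; sum-permute; ∑-distrib-+)
open import Algebra.Properties.CommutativeSemigroup +-commutativeSemigroup using (xy∙z≈xz∙y)
open import Data.Product using (_,_; proj₁; proj₂; ∃-syntax; _×_)
open import Data.Sum using (_⊎_; inj₁; inj₂)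
open import Data.Empty using (⊥; ⊥-elim)
open import Function using (_∘_)
open import Function.Definitions using (Injective; StrictlySurjective)
open import Relation.Binary using (tri<; tri≈; tri>)
open import Relation.Binary.PropositionalEquality
open import Relation.Nullary using (yes; no; contradiction)
open import Relation.Nullary.Decidable using (_×-dec_)

open ≡-Reasoning

module _ {k : ℕ} .{{_ : NonZero k}} where

  %-+-cong : ∀ {x y u v} → x % k ≡ y % k → u % k ≡ v % k → (x + u) % k ≡ (y + v) % k
  %-+-cong {x} {y} {u} {v} x≡y u≡v = begin
    (x + u) % k          ≡⟨ %-distribˡ-+ x u k ⟩
    (x % k + u % k) % k  ≡⟨ cong₂ (λ s t → (s + t) % k) x≡y u≡v ⟩
    (y % k + v % k) % k  ≡⟨ %-distribˡ-+ y v k ⟨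
    (y + v) % k          ∎

  %-+-cancelʳ : ∀ {x y c} → c ≤ k → (x + c) % k ≡ (y + c) % k → x % k ≡ y % k
  %-+-cancelʳ {x} {y} {c} c≤k x+c≡y+c = begin
    x % k                  ≡⟨ add-complement x ⟨
    (x + c + (k ∸ c)) % k  ≡⟨ %-+-cong x+c≡y+c refl ⟩
    (y + c + (k ∸ c)) % k  ≡⟨ add-complement y ⟩
    y % k                  ∎
    where
    add-complement : ∀ z → (z + c + (k ∸ c)) % k ≡ z % k
    add-complement z = trans (cong (_% k) (trans (+-assoc z c (k ∸ c)) (cong (z +_) (m+[n∸m]≡n c≤k))))
                       ([m+n]%n≡m%n z k)

  sum-%-cong : ∀ {n} {f g : Fin n → ℕ} → (∀ j → f j % k ≡ g j % k) → sum f % k ≡ sum g % k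
  sum-%-cong {zero}  _   = refl
  sum-%-cong {suc n} f≡g = %-+-cong (f≡g Fin.zero) (sum-%-cong (f≡g ∘ Fin.suc))

  infixl 6 _-ℤ_

  _-ℤ_ : Fin k → Fin k → Fin k
  a -ℤ b = fromℕ< (m%n<n (toℕ a + (k ∸ toℕ b)) k)

  a-b+b≡a-mod : ∀ a b → (toℕ (a -ℤ b) + toℕ b) % k ≡ toℕ a % k
  a-b+b≡a-mod a b = begin
    (toℕ (a -ℤ b) + toℕ b) % k          ≡⟨ %-+-cong toℕ-a-b refl ⟩
    (toℕ a + (k ∸ toℕ b) + toℕ b) % k   ≡⟨ cong (_% k) (+-assoc (toℕ a) (k ∸ toℕ b) (toℕ b)) ⟩
    (toℕ a + (k ∸ toℕ b + toℕ b)) % k   ≡⟨ cong (λ t → (toℕ a + t) % k) (m∸n+n≡m (<⇒≤ (toℕ<n b))) ⟩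
    (toℕ a + k) % k                     ≡⟨ [m+n]%n≡m%n (toℕ a) k ⟩
    toℕ a % k                           ∎
    where
    toℕ-a-b : toℕ (a -ℤ b) % k ≡ (toℕ a + (k ∸ toℕ b)) % k
    toℕ-a-b = trans (cong (_% k) (toℕ-fromℕ< _)) (m%n%n≡m%n _ k)

  a-b+b-c≡a-c-mod : ∀ a b c → (toℕ (a -ℤ b) + toℕ (b -ℤ c)) % k ≡ toℕ (a -ℤ c) % k
  a-b+b-c≡a-c-mod a b c = %-+-cancelʳ (<⇒≤ (toℕ<n c)) (begin
    (toℕ (a -ℤ b) + toℕ (b -ℤ c) + toℕ c) % k    ≡⟨ cong (_% k) (+-assoc (toℕ (a -ℤ b)) _ _) ⟩
    (toℕ (a -ℤ b) + (toℕ (b -ℤ c) + toℕ c)) % k  ≡⟨ %-+-cong refl (a-b+b≡a-mod b c) ⟩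
    (toℕ (a -ℤ b) + toℕ b) % k                   ≡⟨ a-b+b≡a-mod a b ⟩
    toℕ a % k                                    ≡⟨ a-b+b≡a-mod a c ⟨
    (toℕ (a -ℤ c) + toℕ c) % k                   ∎)

  -ℤ-≡⇒Fair : ∀ {a₁ a₂ b₁ b₂} → a₁ -ℤ b₁ ≡ a₂ -ℤ b₂ → Fair a₁ a₂ b₁ b₂
  -ℤ-≡⇒Fair {a₁} {a₂} {b₁} {b₂} d₁≡d₂ = fromℕ<-cong _ _ (begin
    (toℕ a₁ + toℕ b₂) % k                      ≡⟨ %-+-cong (a-b+b≡a-mod a₁ b₁) refl ⟨
    (toℕ (a₁ -ℤ b₁) + toℕ b₁ + toℕ b₂) % k     ≡⟨ cong (λ d → (toℕ d + toℕ b₁ + toℕ b₂) % k) d₁≡d₂ ⟩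
    (toℕ (a₂ -ℤ b₂) + toℕ b₁ + toℕ b₂) % k     ≡⟨ cong (_% k) (xy∙z≈xz∙y (toℕ (a₂ -ℤ b₂)) _ _) ⟩
    (toℕ (a₂ -ℤ b₂) + toℕ b₂ + toℕ b₁) % k     ≡⟨ %-+-cong (a-b+b≡a-mod a₂ b₂) refl ⟩
    (toℕ a₂ + toℕ b₁) % k                      ∎) _ _

injective⇒strictlySurjective : ∀ {n} {f : Fin n → Fin n} → Injective _≡_ _≡_ f →
                               StrictlySurjective _≡_ f
injective⇒strictlySurjective {suc n} {f} f-inj y with any? (λ x → f x ≟ y)
... | yes hit = hit
... | no miss = contradiction (λ {x} {x′} eq → f-inj (punchOut-injective {i = y} _ _ eq))
                              (<⇒notInjective {f = avoid-y} (n<1+n n))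
  where
  avoid-y : Fin (suc n) → Fin n
  avoid-y x = punchOut {i = y} {j = f x} (λ y≡fx → miss (x , sym y≡fx))

injective⇒permutation : ∀ {n} {f : Fin n → Fin n} → Injective _≡_ _≡_ f → Permutation n n
injective⇒permutation {f = f} f-inj = permutation f (proj₁ ∘ onto) (proj₂ ∘ onto)
                                                   (λ x → f-inj (proj₂ (onto (f x))))
  where
  onto : StrictlySurjective _≡_ f
  onto = injective⇒strictlySurjective f-inj

sum-toℕ-injective : ∀ {n} {f : Fin n → Fin n} → Injective _≡_ _≡_ f → sum (toℕ ∘ f) ≡ sum {n} toℕ
sum-toℕ-injective f-inj = sym (sum-permute toℕ (injective⇒permutation f-inj))

2*sum-toℕ+n≡n*n : ∀ n → 2 * sum {n} toℕ + n ≡ n * n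
2*sum-toℕ+n≡n*n zero    = refl
2*sum-toℕ+n≡n*n (suc n) = begin
  2 * sum {suc n} toℕ + suc n                   ≡⟨ cong (λ s → 2 * s + suc n) sum-toℕ-suc ⟩
  2 * (sum {n} toℕ + n) + suc n                 ≡⟨ solve 2 (λ s n → con 2 :* (s :+ n) :+ (con 1 :+ n)
                                                                  := con 2 :* s :+ n :+ (con 1 :+ n :+ n))
                                                          refl (sum {n} toℕ) n ⟩
  2 * sum {n} toℕ + n + (suc n + n)             ≡⟨ cong (_+ (suc n + n)) (2*sum-toℕ+n≡n*n n) ⟩
  n * n + (suc n + n)                           ≡⟨ solve 1 (λ n → n :* n :+ (con 1 :+ n :+ n)
                                                                  := (con 1 :+ n) :* (con 1 :+ n)) refl n ⟩
  suc n * suc n                                 ∎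
  where
  open +-*-Solver
  sum-toℕ-suc : sum {suc n} toℕ ≡ sum {n} toℕ + n
  sum-toℕ-suc = trans (sum-init-last {n} toℕ)
                      (cong₂ _+_ (sum-cong-≗ {n} toℕ-inject₁) (toℕ-fromℕ n))

sum-toℕ-%-half : ∀ {k q} .{{_ : NonZero k}} → k ≡ q * 2 → sum {k} toℕ % k ≡ q
sum-toℕ-%-half {k} {zero}  k≡0  = contradiction k≡0 (≢-nonZero⁻¹ k)
sum-toℕ-%-half {k} {suc p} refl = begin
  sum {k} toℕ % k      ≡⟨ cong (_% k) sum-toℕ≡ ⟩
  (suc p + p * k) % k  ≡⟨ [m+kn]%n≡m%n (suc p) p k ⟩
  suc p % k            ≡⟨ m<n⇒m%n≡m (m<m*n (suc p) 2 (s<s z<s)) ⟩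
  suc p                ∎
  where
  open +-*-Solver
  sum-toℕ≡ : sum {k} toℕ ≡ suc p + p * k
  sum-toℕ≡ = *-cancelˡ-≡ _ _ 2 (+-cancelʳ-≡ k _ _ (begin
    2 * sum {k} toℕ + k      ≡⟨ 2*sum-toℕ+n≡n*n k ⟩
    k * k                    ≡⟨ solve 1 (λ p → let k = (con 1 :+ p) :* con 2 in
                                             k :* k := con 2 :* ((con 1 :+ p) :+ p :* k) :+ k) refl p ⟩
    2 * (suc p + p * k) + k  ∎))

sum-toℕ-%-≢-double : ∀ {k q} .{{_ : NonZero k}} → k ≡ q * 2 →
                     sum {k} toℕ % k ≢ (sum {k} toℕ + sum {k} toℕ) % k
sum-toℕ-%-≢-double {k} {q} k≡q*2 S≡2S = ≢-nonZero⁻¹ k (trans k≡q*2 (cong (_* 2) q≡0))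
  where
  S : ℕ
  S = sum {k} toℕ
  q≡0 : q ≡ 0
  q≡0 = begin
    q                    ≡⟨ sum-toℕ-%-half k≡q*2 ⟨
    S % k                ≡⟨ S≡2S ⟩
    (S + S) % k          ≡⟨ %-distribˡ-+ S S k ⟩
    (S % k + S % k) % k  ≡⟨ cong (λ r → (r + r) % k) (sum-toℕ-%-half {q = q} k≡q*2) ⟩
    (q + q) % k          ≡⟨ cong (_% k) (trans (cong (q +_) (sym (+-identityʳ q))) (*-comm 2 q)) ⟩
    q * 2 % k            ≡⟨ cong (_% k) k≡q*2 ⟨
    k % k                ≡⟨ n%n≡0 k ⟩
    0                    ∎

collision-or-injective : ∀ {m n} (f : Fin m → Fin n) →
                         (∃[ i ] ∃[ j ] i Fin.< j × f i ≡ f j) ⊎ Injective _≡_ _≡_ f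
collision-or-injective f with any? (λ i → any? (λ j → (i <? j) ×-dec (f i ≟ f j)))
... | yes collision = inj₁ collision
... | no ¬collision = inj₂ f-inj
  where
  f-inj : Injective _≡_ _≡_ f
  f-inj {i} {j} fi≡fj with <-cmp i j
  ... | tri< i<j _ _ = contradiction (i , j , i<j , fi≡fj) ¬collision
  ... | tri≈ _ i≡j _ = i≡j
  ... | tri> _ _ j<i = contradiction (j , i , j<i , sym fi≡fj) ¬collision

module _ {m k : ℕ} .{{_ : NonZero k}} (X : Matrix (ℤ k) m k) where

  rowDifference : Fin m → Fin m → Fin k → Fin k
  rowDifference a b j = X a j -ℤ X b j

  fair-or-injective : ∀ a b → a Fin.< b →
                      HasFairSubmatrix X ⊎ Injective _≡_ _≡_ (rowDifference a b)
  fair-or-injective a b a<b with collision-or-injective (rowDifference a b)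
  ... | inj₁ (i , j , i<j , dᵢ≡dⱼ) =
    inj₁ (a , b , i , j , a<b , i<j , -ℤ-≡⇒Fair {a₁ = X a i} {X a j} {X b i} {X b j} dᵢ≡dⱼ)
  ... | inj₂ d-inj                 = inj₂ d-inj

  ¬injective-rowDifferences : 2 ∣ k → ∀ a b c →
                              Injective _≡_ _≡_ (rowDifference a b) →
                              Injective _≡_ _≡_ (rowDifference b c) →
                              Injective _≡_ _≡_ (rowDifference a c) → ⊥
  ¬injective-rowDifferences (divides q k≡q*2) a b c ab-inj bc-inj ac-inj =
    sum-toℕ-%-≢-double {q = q} k≡q*2 (begin
      sum {k} toℕ % k                           ≡⟨ cong (_% k) (sum-toℕ-injective ac-inj) ⟨
      sum (toℕ ∘ d a c) % k                     ≡⟨ sum-%-cong (λ j → a-b+b-c≡a-c-mod (X a j) (X b j) (X c j)) ⟨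
      sum (λ j → toℕ (d a b j) + toℕ (d b c j)) % k
                                                ≡⟨ cong (_% k) (∑-distrib-+ (toℕ ∘ d a b) (toℕ ∘ d b c)) ⟩
      (sum (toℕ ∘ d a b) + sum (toℕ ∘ d b c)) % k
                                                ≡⟨ cong₂ (λ s t → (s + t) % k) (sum-toℕ-injective ab-inj)
                                                                                (sum-toℕ-injective bc-inj) ⟩
      (sum {k} toℕ + sum {k} toℕ) % k           ∎)
    where
    d : Fin m → Fin m → Fin k → Fin k
    d = rowDifference

lemma2 : (k : ℕ) .{{_ : NonZero k}} → 2 ∣ k →
         (X : Matrix (ℤ k) 3 k) → HasFairSubmatrix X
lemma2 k 2∣k X with fair-or-injective X 0F 1F z<s | fair-or-injective X 1F 2F (s<s z<s)
                  | fair-or-injective X 0F 2F z<s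
... | inj₁ fair | _         | _         = fair
... | _         | inj₁ fair | _         = fair
... | _         | _         | inj₁ fair = fair
... | inj₂ d₀₁  | inj₂ d₁₂  | inj₂ d₀₂  = ⊥-elim (¬injective-rowDifferences X 2∣k _ _ _ d₀₁ d₁₂ d₀₂)
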